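{- Let $\mathcal{I} = (G, r, (f_i)_{i\ge1})$ be an instance of the (offline-optimal) firefighting game where $G$ is a cactus graph. Then there exists an optimal solution (a strategy saving $\mathrm{OPT}(\mathcal{I})$ vertices) in which every simple cycle of $G$ contains at most two protected vertices.
   Context: Firefighting game: $G$ a finite undirected graph, $r$ the fire source, $f_i\ge0$ integers. Initially only $r$ burns. In round $i$ a strategy assigns at most $f_i$ firefighters to vertices that are neither burning nor protected (protected vertices never burn); then fire spreads from each burning vertex to all unprotected neighbours. A vertex is saved if it never burns. $\mathrm{OPT}(\mathcal{I})$ is the maximum number of saved vertices over all strategies (knowing all $f_i$ in advance). A cactus graph is a graph in which every edge lies on at most one simple cycle. -}

module Defs where

open import Data.Nat using (ℕ; zero; suc; _≤_; _≤ᵇ_)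
open import Data.Bool using (Bool; true; false; _∧_; _∨_; not; T)
open import Data.Fin using (Fin; zero; suc)
open import Data.Maybe using (Maybe; just; nothing)
open import Data.List using (List; length; filterᵇ; allFin)
open import Data.Bool.ListAction using (any)
open import Data.List.Relation.Unary.All using (All)
open import Data.List.Relation.Unary.Unique.Propositional using (Unique)
open import Data.Product using (Σ; ∃; _×_; _,_)
open import Data.Sum using (_⊎_)
open import Data.Empty using (⊥)
open import Function using (_⇔_)
open import Function.Definitions using (Injective)
open import Relation.Binary.PropositionalEquality using (_≡_)
open import Relation.Nullary using (¬_)

record Graph (n : ℕ) : Set where
  field
    adj   : Fin n → Fin n → Bool
    sym   : ∀ u v → adj u v ≡ adj v u
    irrefl : ∀ v → adj v v ≡ false
open Graph public

Adj : ∀ {n} → Graph n → Fin n → Fin n → Set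
Adj G u v = T (adj G u v)

next : ∀ {m} → Fin (suc m) → Fin (suc m)
next {zero} zero = zero
next {suc m} zero = suc zero
next {suc m} (suc i) with next {m} i
... | zero = zero
... | suc j = suc (suc j)

record Cycle {n : ℕ} (G : Graph n) : Set where
  field
    len  : ℕ
    vtx  : Fin (suc (suc (suc len))) → Fin n
    inj  : Injective _≡_ _≡_ vtx
    edge : ∀ i → Adj G (vtx i) (vtx (next i))
open Cycle public

CycleEdge : ∀ {n} {G : Graph n} → Cycle G → Fin n → Fin n → Set
CycleEdge C u w = ∃ λ i → (vtx C i ≡ u × vtx C (next i) ≡ w)
                        ⊎ (vtx C i ≡ w × vtx C (next i) ≡ u)

-- Cactus: every edge lies on at most one simple cycle (cycles identified
-- by their edge sets).
Cactus : ∀ {n} → Graph n → Set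
Cactus G = ∀ (C D : Cycle G) u w → CycleEdge C u w → CycleEdge D u w →
           ∀ x y → (CycleEdge C x y ⇔ CycleEdge D x y)

-- A strategy: for each vertex, the round (≥ 1) in which it receives a
-- firefighter, or nothing if it is never protected.
Strategy : ℕ → Set
Strategy n = Fin n → Maybe ℕ

isAt : Maybe ℕ → ℕ → Bool
isAt nothing  i = false
isAt (just j) i = (j ≤ᵇ i) ∧ (i ≤ᵇ j)

isBy : Maybe ℕ → ℕ → Bool
isBy nothing  i = false
isBy (just j) i = j ≤ᵇ i

-- burning G r p i v : v is burning at the end of round i (round 0 = start).
burning : ∀ {n} → Graph n → Fin n → Strategy n → ℕ → Fin n → Bool
burning {n} G r p zero v with r Data.Fin.≟ v
... | Relation.Nullary.yes _ = true
... | Relation.Nullary.no _ = false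
burning {n} G r p (suc i) v =
  burning G r p i v ∨
  (not (isBy (p v) (suc i)) ∧
   any (λ u → burning G r p i u ∧ adj G u v) (allFin n))

placedAt : ∀ {n} → Strategy n → ℕ → ℕ
placedAt {n} p i = length (filterᵇ (λ v → isAt (p v) i) (allFin n))

Valid : ∀ {n} → Graph n → Fin n → (ℕ → ℕ) → Strategy n → Set
Valid {n} G r f p =
  (∀ v j → p v ≡ just j → ∃ λ k → j ≡ suc k × burning G r p k v ≡ false)
  × (∀ i → placedAt p i ≤ f i)

Saved : ∀ {n} → Graph n → Fin n → Strategy n → Fin n → Set
Saved G r p v = ∀ i → burning G r p i v ≡ false

SavesAtLeast : ∀ {n} → Graph n → Fin n → Strategy n → ℕ → Set
SavesAtLeast {n} G r p k =
  ∃ λ (vs : List (Fin n)) → length vs ≡ k × Unique vs × All (Saved G r p) vs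

Optimal : ∀ {n} → Graph n → Fin n → (ℕ → ℕ) → Strategy n → Set
Optimal {n} G r f p =
  Valid G r f p ×
  (∀ q → Valid G r f q → ∀ k → SavesAtLeast G r q k → SavesAtLeast G r p k)

Protected : ∀ {n} → Strategy n → Fin n → Set
Protected p v = ∃ λ j → p v ≡ just j

AtMostTwoProtected : ∀ {n} {G : Graph n} → Strategy n → Cycle G → Set
AtMostTwoProtected p C =
  ∀ i j k → ¬ i ≡ j → ¬ j ≡ k → ¬ i ≡ k →
  Protected p (vtx C i) → Protected p (vtx C j) → ¬ Protected p (vtx C k)

-- Drop every protection of a vertex that has no burning neighbour once the fire has stopped
-- (after n rounds). The fire is unaffected, so an optimal strategy stays optimal, and now every
-- protected vertex a is reached by a simple walk from r all of whose other vertices burn, hence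
-- are unprotected. In a cactus every simple walk from r enters a cycle C at one and the same
-- vertex e, since a second entry point would be joined to the first by a walk outside C, closing
-- a cycle that shares an edge with C. After entering, a simple walk can only proceed along C.
-- Of three protected vertices of C, two bound an arc of C that contains e and misses the third,
-- so the walk to the third would have to pass a protected vertex. Optimal strategies exist
-- because pruned strategies act only in rounds up to n + 1, and there are finitely many of those.

module Submission where

open import Defs hiding (sym)
open import Data.Nat using (ℕ; zero; suc; _≤_; _<_; _≤′_; ≤′-refl; ≤′-step; z≤n; s≤s; _+_; _∸_; _≤?_)
open import Data.Nat.Properties
open import Data.Fin as Fin using (Fin; zero; suc; toℕ; fromℕ)
import Data.Fin.Properties as Finₚ
open import Data.List hiding (last; any; or)
open import Data.List.Properties
open import Data.List.Relation.Unary.All as All using (All; []; _∷_)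
import Data.List.Relation.Unary.All.Properties as Allₚ
open import Data.List.Relation.Unary.Any as Any using (Any; here; there)
import Data.List.Relation.Unary.Any.Properties as Anyₚ
open import Data.List.Relation.Unary.Unique.Propositional using (Unique; []; _∷_)
import Data.List.Relation.Unary.Unique.Propositional.Properties as Uniqueₚ
open import Data.List.Membership.Propositional using (_∈_; _∉_; lose)
open import Data.List.Membership.Propositional.Properties
  using (∈-lookup; ∈-++⁺ˡ; ∈-++⁺ʳ; ∈-++⁻; ∈-∃++; ∈-filter⁺; ∈-filter⁻; ∈-allFin;
         ∈-map⁺; ∈-map⁻; ∈-upTo⁺; ∈-upTo⁻;
         ∈-cartesianProductWith⁺; ∈-cartesianProductWith⁻)
open import Data.List.Relation.Binary.Sublist.Propositional using (⊆-refl)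
import Data.List.Relation.Binary.Sublist.Propositional.Properties as Sublistₚ
open import Data.List.Relation.Binary.Equality.Propositional using (≋⇒≡)
import Data.Vec.Functional as Vector
open import Data.Product using (Σ; ∃; _×_; _,_; proj₁; proj₂)
open import Data.Sum as Sum using (_⊎_; inj₁; inj₂)
open import Data.Maybe using (Maybe; just; nothing)
open import Data.Empty
import Data.Bool as Bool
open import Data.Bool using (Bool; true; false; T; not; _∧_; _∨_; if_then_else_)
open import Data.Bool.Properties using (T-∧; T-∨; T-not-≡; ∧-zeroʳ)
open import Data.Bool.ListAction using (any; or)
open import Data.Unit using (⊤; tt)
open import Function using (id; _∘_; case_of_; Equivalence)
open import Relation.Binary.PropositionalEquality hiding ([_])
open import Relation.Nullary
open import Relation.Nullary.Decidable using (T?; _×-dec_; _⊎-dec_)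
open import Relation.Unary using (Decidable)
open import Relation.Binary using (Tri; tri<; tri≈; tri>)

private
  variable
    A : Set
    P : A → Set

lastOf : A → List A → A
lastOf x []       = x
lastOf x (y ∷ ys) = lastOf y ys

lastOf-++-∷ : ∀ (x : A) xs y ys → lastOf x (xs ++ y ∷ ys) ≡ lastOf y ys
lastOf-++-∷ x []       y ys = refl
lastOf-++-∷ x (z ∷ xs) y ys = lastOf-++-∷ z xs y ys

lastOf-∈ : ∀ (x : A) xs → lastOf x xs ∈ x ∷ xs
lastOf-∈ x []       = here refl
lastOf-∈ x (y ∷ ys) = there (lastOf-∈ y ys)

reverse-∷-++-[] : ∀ (x : A) ys z → reverse (x ∷ ys ++ [ z ]) ≡ z ∷ reverse ys ++ [ x ]
reverse-∷-++-[] x ys z = begin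
  reverse (x ∷ ys ++ [ z ])    ≡⟨ unfold-reverse x (ys ++ [ z ]) ⟩
  reverse (ys ++ [ z ]) ++ [ x ] ≡⟨ cong (_++ [ x ]) (reverse-++ ys [ z ]) ⟩
  z ∷ reverse ys ++ [ x ]       ∎
  where open ≡-Reasoning

All-reverse⁺ : ∀ {xs} → All P xs → All P (reverse xs)
All-reverse⁺ ps = All.tabulate (All.lookup ps ∘ Anyₚ.reverse⁻)

Unique-reverse⁺ : ∀ {xs : List A} → Unique xs → Unique (reverse xs)
Unique-reverse⁺ {xs = []}     []         = []
Unique-reverse⁺ {xs = x ∷ xs} (x∉ ∷ xs!) rewrite unfold-reverse x xs =
  Uniqueₚ.++⁺ (Unique-reverse⁺ xs!) ([] ∷ [])
    λ { (y∈ , here refl) → All.lookup x∉ (Anyₚ.reverse⁻ y∈) refl }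

Unique-++⁻ˡ : ∀ (xs ys : List A) → Unique (xs ++ ys) → Unique xs
Unique-++⁻ˡ []       ys _          = []
Unique-++⁻ˡ (x ∷ xs) ys (x∉ ∷ xs!) = Allₚ.++⁻ˡ xs x∉ ∷ Unique-++⁻ˡ xs ys xs!

Unique-++⁻ʳ : ∀ (xs ys : List A) → Unique (xs ++ ys) → Unique ys
Unique-++⁻ʳ []       ys u         = u
Unique-++⁻ʳ (x ∷ xs) ys (_ ∷ xs!) = Unique-++⁻ʳ xs ys xs!

Unique-++-∷⇒∉ : ∀ (xs : List A) y ys → Unique (xs ++ y ∷ ys) → y ∉ xs
Unique-++-∷⇒∉ (x ∷ xs) y ys (x∉ ∷ _) (here refl) = All.lookup x∉ (∈-++⁺ʳ xs (here refl)) refl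
Unique-++-∷⇒∉ (x ∷ xs) y ys (_ ∷ u)  (there y∈) = Unique-++-∷⇒∉ xs y ys u y∈

Unique-∷ʳ⁺ : ∀ {xs : List A} {y} → Unique xs → y ∉ xs → Unique (xs ++ [ y ])
Unique-∷ʳ⁺ u y∉ = Uniqueₚ.++⁺ u ([] ∷ []) λ { (y∈ , here refl) → y∉ y∈ }

Unique-length-≤ : ∀ (xs ys : List A) → Unique xs → (∀ {x} → x ∈ xs → x ∈ ys) → length xs ≤ length ys
Unique-length-≤ []       ys _          _  = z≤n
Unique-length-≤ (x ∷ xs) ys (x∉ ∷ xs!) xs⊆ with ∈-∃++ (xs⊆ (here refl))
... | ys₁ , ys₂ , refl = begin
  suc (length xs)           ≤⟨ s≤s (Unique-length-≤ xs (ys₁ ++ ys₂) xs! xs⊆ys₁ys₂) ⟩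
  suc (length (ys₁ ++ ys₂)) ≡⟨ cong suc (length-++ ys₁) ⟩
  suc (length ys₁ + length ys₂) ≡⟨ +-suc (length ys₁) (length ys₂) ⟨
  length ys₁ + length (x ∷ ys₂) ≡⟨ length-++ ys₁ ⟨
  length (ys₁ ++ x ∷ ys₂) ∎
  where
  open ≤-Reasoning
  xs⊆ys₁ys₂ : ∀ {y} → y ∈ xs → y ∈ ys₁ ++ ys₂
  xs⊆ys₁ys₂ {y} y∈ with ∈-++⁻ ys₁ (xs⊆ (there y∈))
  ... | inj₁ y∈₁         = ∈-++⁺ˡ y∈₁
  ... | inj₂ (here refl) = ⊥-elim (All.lookup x∉ y∈ refl)
  ... | inj₂ (there y∈₂) = ∈-++⁺ʳ ys₁ y∈₂

lookup-injective : ∀ (xs : List A) → Unique xs → ∀ i j → lookup xs i ≡ lookup xs j → i ≡ j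
lookup-injective (x ∷ xs) _          zero    zero    _  = refl
lookup-injective (x ∷ xs) (x∉ ∷ _)   zero    (suc j) eq = ⊥-elim (All.lookup x∉ (∈-lookup j) eq)
lookup-injective (x ∷ xs) (x∉ ∷ _)   (suc i) zero    eq = ⊥-elim (All.lookup x∉ (∈-lookup i) (sym eq))
lookup-injective (x ∷ xs) (_ ∷ xs!)  (suc i) (suc j) eq = cong suc (lookup-injective xs xs! i j eq)

lookup-fromℕ-length : ∀ (x : A) xs → lookup (x ∷ xs) (fromℕ (length xs)) ≡ lastOf x xs
lookup-fromℕ-length x []       = refl
lookup-fromℕ-length x (y ∷ ys) = lookup-fromℕ-length y ys

length-filterᵇ-mono : ∀ (f g : A → Bool) → (∀ {x} → T (f x) → T (g x)) → ∀ xs →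
             length (filterᵇ f xs) ≤ length (filterᵇ g xs)
length-filterᵇ-mono f g f⇒g xs =
  Sublistₚ.length-mono-≤ (Sublistₚ.filter⁺ (T? ∘ f) (T? ∘ g) (λ { refl → f⇒g }) (⊆-refl {x = xs}))

length-filterᵇ-mono-< : ∀ (f g : A → Bool) → (∀ {x} → T (f x) → T (g x)) →
                        ∀ {xs y} → y ∈ xs → T (g y) → ¬ T (f y) →
                        length (filterᵇ f xs) < length (filterᵇ g xs)
length-filterᵇ-mono-< f g f⇒g {xs} {y} y∈ gy ¬fy = ≤∧≢⇒< (Sublistₚ.length-mono-≤ sub) λ same →
  ¬fy (proj₂ (∈-filter⁻ (T? ∘ f) {xs = xs}
    (subst (y ∈_) (sym (≋⇒≡ (Sublistₚ.to-≋ same sub))) (∈-filter⁺ (T? ∘ g) y∈ gy))))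
  where sub = Sublistₚ.filter⁺ (T? ∘ f) (T? ∘ g) (λ { refl → f⇒g }) (⊆-refl {x = xs})

filterᵇ-cong : ∀ {f g : A → Bool} → (∀ x → f x ≡ g x) → ∀ xs → filterᵇ f xs ≡ filterᵇ g xs
filterᵇ-cong {f = f} {g} f≗g =
  filter-≐ (T? ∘ f) (T? ∘ g) ((λ {x} → subst T (f≗g x)) , (λ {x} → subst T (sym (f≗g x))))

argmax : ∀ (g : A → ℕ) xs → (∀ {x} → x ∈ xs → Dec (P x)) → ∀ {x₀} → P x₀ →
         ∃ λ b → P b × (∀ {x} → x ∈ xs → P x → g x ≤ g b)
argmax g []       _  {x₀} px₀ = x₀ , px₀ , λ ()
argmax g (x ∷ xs) P? px₀ with argmax g xs (P? ∘ there) px₀ | P? (here refl)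
... | b , pb , best | no ¬px = b , pb , λ { (here refl) px → ⊥-elim (¬px px) ; (there x∈) → best x∈ }
... | b , pb , best | yes px with g x ≤? g b
...   | yes gx≤gb = b , pb , λ { (here refl) _ → gx≤gb ; (there x∈) → best x∈ }
...   | no gx≰gb  = x , px , λ { (here refl) _ → ≤-refl
                                ; (there x∈) px′ → ≤-trans (best x∈ px′) (<⇒≤ (≰⇒> gx≰gb)) }

allFunctions : List A → (k : ℕ) → List (Fin k → A)
allFunctions as zero    = [ (λ ()) ]
allFunctions as (suc k) = cartesianProductWith Vector._∷_ as (allFunctions as k)

allFunctions-complete : ∀ as {k} (p : Fin k → A) → (∀ i → p i ∈ as) →
                        ∃ λ q → q ∈ allFunctions as k × (∀ i → q i ≡ p i)
allFunctions-complete as {zero}  p _   = (λ ()) , here refl , λ ()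
allFunctions-complete as {suc k} p p∈ with allFunctions-complete as (p ∘ suc) (p∈ ∘ suc)
... | q , q∈ , q≗ = p zero Vector.∷ q , ∈-cartesianProductWith⁺ Vector._∷_ (p∈ zero) q∈ ,
                    λ { zero → refl ; (suc i) → q≗ i }

allFunctions-sound : ∀ as {k} {q : Fin k → A} → q ∈ allFunctions as k → ∀ i → q i ∈ as
allFunctions-sound as {suc k} q∈ i with ∈-cartesianProductWith⁻ Vector._∷_ as (allFunctions as k) q∈
allFunctions-sound as {suc k} q∈ zero    | _ , _ , a∈ , _  , refl = a∈
allFunctions-sound as {suc k} q∈ (suc i) | _ , _ , _  , q∈′ , refl = allFunctions-sound as q∈′ i

record FirstSplit (P : A → Set) (xs : List A) : Set where
  constructor firstAt
  field
    before      : List A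
    found       : A
    after       : List A
    split       : xs ≡ before ++ found ∷ after
    none-before : All (¬_ ∘ P) before
    holds       : P found

firstSplit : Decidable P → ∀ {xs} → Any P xs → FirstSplit P xs
firstSplit P? {x ∷ xs} any with P? x | any
... | yes px | _        = firstAt [] x xs refl [] px
... | no ¬px | here px  = ⊥-elim (¬px px)
... | no ¬px | there any with firstSplit P? any
...   | firstAt bs y as eq none py = firstAt (x ∷ bs) y as (cong (x ∷_) eq) (¬px ∷ none) py

-- The cyclic successor

next-cases : ∀ {m} (i : Fin (suc m)) →
             (toℕ i ≡ m × next i ≡ zero) ⊎ (toℕ i < m × toℕ (next i) ≡ suc (toℕ i))
next-cases {zero}  zero    = inj₁ (refl , refl)
next-cases {suc m} zero    = inj₂ (s≤s z≤n , refl)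
next-cases {suc m} (suc i) with next-cases {m} i
... | inj₁ (i≡m , next≡0) rewrite next≡0 = inj₁ (cong suc i≡m , refl)
... | inj₂ (i<m , eq) with next {m} i
...   | zero  = ⊥-elim (0≢1+n eq)
...   | suc j = inj₂ (s≤s i<m , cong suc eq)

next-fromℕ : ∀ m → next (fromℕ m) ≡ zero
next-fromℕ m with next-cases (fromℕ m)
... | inj₁ (_ , next≡0) = next≡0
... | inj₂ (m<m , _)    = ⊥-elim (<-irrefl (Finₚ.toℕ-fromℕ m) m<m)

clamp : ∀ m → ℕ → Fin (suc m)
clamp zero    _       = zero
clamp (suc m) zero    = zero
clamp (suc m) (suc t) = suc (clamp m t)

toℕ-clamp : ∀ m t → t ≤ m → toℕ (clamp m t) ≡ t
toℕ-clamp zero    zero    _         = refl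
toℕ-clamp (suc m) zero    _         = refl
toℕ-clamp (suc m) (suc t) (s≤s t≤m) = cong suc (toℕ-clamp m t t≤m)

clamp-toℕ : ∀ m (i : Fin (suc m)) → clamp m (toℕ i) ≡ i
clamp-toℕ zero    zero    = refl
clamp-toℕ (suc m) zero    = refl
clamp-toℕ (suc m) (suc i) = cong suc (clamp-toℕ m i)

next-clamp : ∀ m t → t < m → next (clamp m t) ≡ clamp m (suc t)
next-clamp m t t<m with next-cases (clamp m t)
... | inj₁ (t≡m , _) = ⊥-elim (<-irrefl (trans (sym (toℕ-clamp m t (<⇒≤ t<m))) t≡m) t<m)
... | inj₂ (_ , eq)  = Finₚ.toℕ-injective (begin
  toℕ (next (clamp m t)) ≡⟨ eq ⟩
  suc (toℕ (clamp m t))  ≡⟨ cong suc (toℕ-clamp m t (<⇒≤ t<m)) ⟩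
  suc t                  ≡⟨ toℕ-clamp m (suc t) t<m ⟨
  toℕ (clamp m (suc t))  ∎)
  where open ≡-Reasoning

module _ {m : ℕ} (x z : Fin (suc m)) where

  Between Outside : Fin (suc m) → Set
  Between q = toℕ x < toℕ q × toℕ q < toℕ z
  Outside q = toℕ q < toℕ x ⊎ toℕ z < toℕ q

  Between-next : ∀ q → Between q → next q ≢ z → Between (next q)
  Between-next q (x<q , q<z) next≢z with next-cases q
  ... | inj₁ (q≡m , _) = ⊥-elim (<-irrefl refl (<-≤-trans (subst (_< toℕ z) q≡m q<z) (Finₚ.toℕ≤pred[n] z)))
  ... | inj₂ (_ , eq)  = subst (toℕ x <_) (sym eq) (m<n⇒m<1+n x<q) ,
                         ≤∧≢⇒< (subst (_≤ toℕ z) (sym eq) q<z) (next≢z ∘ Finₚ.toℕ-injective)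

  Between-prev : ∀ q → Between (next q) → q ≢ x → Between q
  Between-prev q (x<next , next<z) q≢x with next-cases q
  ... | inj₁ (_ , next≡0) rewrite next≡0 = ⊥-elim (n≮0 x<next)
  ... | inj₂ (_ , eq) rewrite eq =
    ≤∧≢⇒< (≤-pred x<next) (q≢x ∘ sym ∘ Finₚ.toℕ-injective) , <-trans (n<1+n _) next<z

  Outside-next : ∀ q → Outside q → next q ≢ x → Outside (next q)
  Outside-next q out next≢x with next-cases q
  ... | inj₁ (_ , next≡0) rewrite next≡0 = inj₁ (≤∧≢⇒< z≤n (next≢x ∘ Finₚ.toℕ-injective))
  ... | inj₂ (_ , eq) rewrite eq with out
  ...   | inj₁ q<x = inj₁ (≤∧≢⇒< q<x (next≢x ∘ Finₚ.toℕ-injective ∘ trans eq))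
  ...   | inj₂ z<q = inj₂ (m<n⇒m<1+n z<q)

  Outside-prev : ∀ q → Outside (next q) → q ≢ z → Outside q
  Outside-prev q out q≢z with next-cases q
  ... | inj₁ (q≡m , _) =
    inj₂ (≤∧≢⇒< (subst (toℕ z ≤_) (sym q≡m) (Finₚ.toℕ≤pred[n] z)) (q≢z ∘ sym ∘ Finₚ.toℕ-injective))
  ... | inj₂ (_ , eq) rewrite eq with out
  ...   | inj₁ next<x = inj₁ (<-trans (n<1+n _) next<x)
  ...   | inj₂ z<next = inj₂ (≤∧≢⇒< (≤-pred z<next) (q≢z ∘ sym ∘ Finₚ.toℕ-injective))

sort3 : ∀ {k} (P : Fin k → Set) → (∀ {x y z} → x Fin.< y → y Fin.< z → P x → P y → P z → ⊥) →
        ∀ {x y z} → x ≢ y → y ≢ z → x ≢ z → P x → P y → P z → ⊥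
sort3 P sorted {x} {y} {z} x≢y y≢z x≢z px py pz with Finₚ.<-cmp x y | Finₚ.<-cmp y z | Finₚ.<-cmp x z
... | tri≈ _ x≡y _ | _ | _ = x≢y x≡y
... | _ | tri≈ _ y≡z _ | _ = y≢z y≡z
... | _ | _ | tri≈ _ x≡z _ = x≢z x≡z
... | tri< x<y _ _ | tri< y<z _ _ | _            = sorted x<y y<z px py pz
... | tri< x<y _ _ | tri> _ _ z<y | tri< x<z _ _ = sorted x<z z<y px pz py
... | tri< x<y _ _ | tri> _ _ z<y | tri> _ _ z<x = sorted z<x x<y pz px py
... | tri> _ _ y<x | tri< y<z _ _ | tri< x<z _ _ = sorted y<x x<z py px pz
... | tri> _ _ y<x | tri< y<z _ _ | tri> _ _ z<x = sorted y<z z<x py pz px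
... | tri> _ _ y<x | tri> _ _ z<y | _            = sorted z<y y<x pz py px

-- Walks

module Walks {n : ℕ} (G : Graph n) where

  Walk : List (Fin n) → Set
  Walk []           = ⊤
  Walk (x ∷ [])     = ⊤
  Walk (x ∷ y ∷ ys) = Adj G x y × Walk (y ∷ ys)

  ClosedWalk : List (Fin n) → Set
  ClosedWalk []       = ⊤
  ClosedWalk (x ∷ xs) = Walk (x ∷ xs ++ [ x ])

  Adj-sym : ∀ {x y} → Adj G x y → Adj G y x
  Adj-sym {x} {y} = subst T (Graph.sym G x y)

  Walk-++ : ∀ x xs ys → Walk (x ∷ xs) → Walk (lastOf x xs ∷ ys) → Walk (x ∷ xs ++ ys)
  Walk-++ x []       ys _        w  = w
  Walk-++ x (y ∷ xs) ys (xy , w) w′ = xy , Walk-++ y xs ys w w′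

  Walk-++⁻ˡ : ∀ x xs ys → Walk (x ∷ xs ++ ys) → Walk (x ∷ xs)
  Walk-++⁻ˡ x []       ys _        = tt
  Walk-++⁻ˡ x (y ∷ xs) ys (xy , w) = xy , Walk-++⁻ˡ y xs ys w

  Walk-++⁻ʳ : ∀ x xs ys → Walk (x ∷ xs ++ ys) → Walk (lastOf x xs ∷ ys)
  Walk-++⁻ʳ x []       ys w       = w
  Walk-++⁻ʳ x (y ∷ xs) ys (_ , w) = Walk-++⁻ʳ y xs ys w

  Walk-prefix : ∀ xs y ys → Walk (xs ++ y ∷ ys) → Walk (xs ++ [ y ])
  Walk-prefix []           y ys _        = tt
  Walk-prefix (x ∷ [])     y ys (xy , _) = xy , tt
  Walk-prefix (x ∷ x′ ∷ xs) y ys (xx′ , w) = xx′ , Walk-prefix (x′ ∷ xs) y ys w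

  Walk-suffix : ∀ xs y ys → Walk (xs ++ y ∷ ys) → Walk (y ∷ ys)
  Walk-suffix []            y ys w       = w
  Walk-suffix (x ∷ [])      y ys (_ , w) = w
  Walk-suffix (x ∷ x′ ∷ xs) y ys (_ , w) = Walk-suffix (x′ ∷ xs) y ys w

  Walk-glue : ∀ xs y ys → Walk (xs ++ [ y ]) → Walk (y ∷ ys) → Walk (xs ++ y ∷ ys)
  Walk-glue []            y ys _         w′ = w′
  Walk-glue (x ∷ [])      y ys (xy , _)  w′ = xy , w′
  Walk-glue (x ∷ x′ ∷ xs) y ys (xx′ , w) w′ = xx′ , Walk-glue (x′ ∷ xs) y ys w w′

  Walk-reverse : ∀ xs → Walk xs → Walk (reverse xs)
  Walk-reverse []       _ = tt
  Walk-reverse (x ∷ xs) w = go xs x [] w tt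
    where
    go : ∀ xs y acc → Walk (y ∷ xs) → Walk (y ∷ acc) → Walk (reverseAcc (y ∷ acc) xs)
    go []       y acc _        w′ = w′
    go (z ∷ zs) y acc (yz , w) w′ = go zs z (y ∷ acc) w (Adj-sym yz , w′)

  Walk-reverse-prefix : ∀ pre e post → Walk (pre ++ e ∷ post) → Walk (e ∷ reverse pre)
  Walk-reverse-prefix pre e post w = subst Walk (reverse-++ pre [ e ]) (Walk-reverse _ (Walk-prefix pre e post w))

  Walk-lookup : ∀ xs → Walk xs → ∀ (i j : Fin (length xs)) → toℕ j ≡ suc (toℕ i) →
                Adj G (lookup xs i) (lookup xs j)
  Walk-lookup (x ∷ y ∷ ys) (xy , _) zero    (suc zero)    refl = xy
  Walk-lookup (x ∷ y ∷ ys) (_ , w)  (suc i) (suc j)       eq   = Walk-lookup (y ∷ ys) w i j (suc-injective eq)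
  Walk-lookup (x ∷ y ∷ ys) _        zero    (suc (suc j)) ()
  Walk-lookup (x ∷ [])     _        zero    zero          ()

  closedWalk⇒Cycle : ∀ ws → 3 ≤ length ws → Unique ws → ClosedWalk ws → Cycle G
  closedWalk⇒Cycle ws@(x ∷ y ∷ z ∷ rest) _ ws! closed = record
    { len  = length rest
    ; vtx  = lookup ws
    ; inj  = λ {i} {j} → lookup-injective ws ws! i j
    ; edge = consecutive
    }
    where
    open-walk = Walk-++⁻ˡ x (y ∷ z ∷ rest) [ x ] closed
    closing   = Walk-++⁻ʳ x (y ∷ z ∷ rest) [ x ] closed
    consecutive : ∀ i → Adj G (lookup ws i) (lookup ws (next i))
    consecutive i with next-cases i
    ... | inj₂ (_ , eq)     = Walk-lookup ws open-walk i (next i) eq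
    ... | inj₁ (i≡m , next≡0) rewrite next≡0
                            | Finₚ.toℕ-injective (trans i≡m (sym (Finₚ.toℕ-fromℕ _)))
                            | lookup-fromℕ-length x (y ∷ z ∷ rest) = proj₁ closing
  closedWalk⇒Cycle (_ ∷ [])     (s≤s ())       _ _
  closedWalk⇒Cycle (_ ∷ _ ∷ []) (s≤s (s≤s ())) _ _

  closedWalk⇒Cycle-first : ∀ x y xs h u w → CycleEdge (closedWalk⇒Cycle (x ∷ y ∷ xs) h u w) x y
  closedWalk⇒Cycle-first x y (z ∷ xs) h u w = zero , inj₁ (refl , refl)
  closedWalk⇒Cycle-first x y [] (s≤s (s≤s ())) u w

  closedWalk⇒Cycle-closing : ∀ x xs h u w → CycleEdge (closedWalk⇒Cycle (x ∷ xs) h u w) (lastOf x xs) x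
  closedWalk⇒Cycle-closing x (y ∷ z ∷ rest) h u w =
    fromℕ (suc (suc (length rest))) ,
    inj₁ (lookup-fromℕ-length x (y ∷ z ∷ rest) , cong (lookup (x ∷ y ∷ z ∷ rest)) (next-fromℕ _))
  closedWalk⇒Cycle-closing x []       (s≤s ())       u w
  closedWalk⇒Cycle-closing x (_ ∷ []) (s≤s (s≤s ())) u w

  -- Follow the first walk until it hits the second, then the second one backwards.
  meetingWalk : ∀ {P : Fin n → Set} {r} u v as bs → Walk (u ∷ as) → Walk (v ∷ bs) → Unique as → Unique bs →
         r ∈ as → r ∈ bs → All P as → All P bs →
         ∃ λ qs → qs ≢ [] × Unique qs × All P qs × Walk (u ∷ qs ++ [ v ])
  meetingWalk u v as bs walk₁ walk₂ as! bs! r∈as r∈bs Pas Pbs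
    with firstSplit (λ w → Any.any? (w Fin.≟_) bs) (lose r∈as r∈bs)
  ... | firstAt as₁ z as₂ refl none-in-bs z∈bs with ∈-∃++ z∈bs
  ... | bs₁ , bs₂ , refl = as₁ ++ z ∷ reverse bs₁ , nonEmpty as₁ , unique , allP , walk
    where
    nonEmpty : ∀ xs → xs ++ z ∷ reverse bs₁ ≢ []
    nonEmpty []      ()
    nonEmpty (_ ∷ _) ()
    z∉bs₁ : z ∉ bs₁
    z∉bs₁ = Unique-++-∷⇒∉ bs₁ z bs₂ bs!
    unique : Unique (as₁ ++ z ∷ reverse bs₁)
    unique = Uniqueₚ.++⁺ (Unique-++⁻ˡ as₁ _ as!)
               (All.tabulate (λ w∈ z≡w → z∉bs₁ (Anyₚ.reverse⁻ (subst (_∈ reverse bs₁) (sym z≡w) w∈)))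
                 ∷ Unique-reverse⁺ (Unique-++⁻ˡ bs₁ _ bs!))
               λ { (w∈as₁ , here refl)  → All.lookup none-in-bs w∈as₁ z∈bs
                 ; (w∈as₁ , there w∈bs₁) →
                     All.lookup none-in-bs w∈as₁ (∈-++⁺ˡ (Anyₚ.reverse⁻ {xs = bs₁} w∈bs₁)) }
    allP : All _ (as₁ ++ z ∷ reverse bs₁)
    allP = Allₚ.++⁺ (Allₚ.++⁻ˡ as₁ Pas) (All.head (Allₚ.++⁻ʳ as₁ Pas) ∷ All-reverse⁺ (Allₚ.++⁻ˡ bs₁ Pbs))
    back : Walk (z ∷ reverse bs₁ ++ [ v ])
    back = subst Walk (reverse-∷-++-[] v bs₁ z) (Walk-reverse _ (Walk-prefix (v ∷ bs₁) z bs₂ walk₂))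
    walk : Walk (u ∷ (as₁ ++ z ∷ reverse bs₁) ++ [ v ])
    walk = subst (λ xs → Walk (u ∷ xs)) (sym (++-assoc as₁ (z ∷ reverse bs₁) [ v ]))
             (Walk-glue (u ∷ as₁) z (reverse bs₁ ++ [ v ]) (Walk-prefix (u ∷ as₁) z as₂ walk₁) back)

  Unblocked : (Fin n → Set) → Fin n → Fin n → Set
  Unblocked S r a = ∃ λ ts → Walk (r ∷ ts ++ [ a ]) × Unique (r ∷ ts ++ [ a ]) × All (¬_ ∘ S) (r ∷ ts)

-- Walks meeting a cycle of a cactus

module CactusCycle {n : ℕ} {G : Graph n} (cactus : Cactus G) (C : Cycle G) where
  open Walks G

  m : ℕ
  m = suc (suc (len C))

  OnCycle : Fin n → Set
  OnCycle w = ∃ λ i → vtx C i ≡ w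

  onCycle? : Decidable OnCycle
  onCycle? w = Finₚ.any? (λ i → vtx C i Fin.≟ w)

  cycleEdge? : ∀ u w → Dec (CycleEdge C u w)
  cycleEdge? u w = Finₚ.any? λ i → ((vtx C i Fin.≟ u) ×-dec (vtx C (next i) Fin.≟ w))
                                   ⊎-dec ((vtx C i Fin.≟ w) ×-dec (vtx C (next i) Fin.≟ u))

  CycleEdge-sym : ∀ {u w} → CycleEdge C u w → CycleEdge C w u
  CycleEdge-sym (i , e) = i , Sum.swap e

  CycleEdge⇒OnCycle : ∀ {u w} → CycleEdge C u w → OnCycle u
  CycleEdge⇒OnCycle (i , inj₁ (iu , _)) = i , iu
  CycleEdge⇒OnCycle (i , inj₂ (_ , iu)) = next i , iu

  CycleEdge-indices : ∀ {i k} → CycleEdge C (vtx C i) (vtx C k) → k ≡ next i ⊎ i ≡ next k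
  CycleEdge-indices (q , inj₁ (qi , qk)) = inj₁ (trans (sym (inj C qk)) (cong next (inj C qi)))
  CycleEdge-indices (q , inj₂ (qk , qi)) = inj₂ (trans (sym (inj C qi)) (cong next (inj C qk)))

  -- The t-th vertex of C; only t ≤ m is meaningful.
  c : ℕ → Fin n
  c t = vtx C (clamp m t)

  vtx≡c : ∀ i → vtx C i ≡ c (toℕ i)
  vtx≡c i = cong (vtx C) (sym (clamp-toℕ m i))

  c-adj : ∀ t → t < m → Adj G (c t) (c (suc t))
  c-adj t t<m = subst (λ i → Adj G (c t) (vtx C i)) (next-clamp m t t<m) (edge C (clamp m t))

  c-CycleEdge : ∀ t → t < m → CycleEdge C (c t) (c (suc t))
  c-CycleEdge t t<m = clamp m t , inj₁ (refl , cong (vtx C) (next-clamp m t t<m))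

  c-injective : ∀ {t s} → t ≤ m → s ≤ m → c t ≡ c s → t ≡ s
  c-injective {t} {s} t≤m s≤m eq =
    trans (sym (toℕ-clamp m t t≤m)) (trans (cong toℕ (inj C eq)) (toℕ-clamp m s s≤m))

  arc : ℕ → ℕ → List (Fin n)
  arc a zero    = []
  arc a (suc k) = c (suc a) ∷ arc (suc a) k

  Walk-arc : ∀ a k → a + k ≤ m → Walk (c a ∷ arc a k)
  Walk-arc a zero    _     = tt
  Walk-arc a (suc k) a+k≤m = c-adj a (<-≤-trans (m<m+n a (s≤s z≤n)) a+k≤m) ,
                             Walk-arc (suc a) k (subst (_≤ m) (+-suc a k) a+k≤m)

  lastOf-arc : ∀ a k → lastOf (c a) (arc a k) ≡ c (a + k)
  lastOf-arc a zero    = cong c (sym (+-identityʳ a))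
  lastOf-arc a (suc k) = trans (lastOf-arc (suc a) k) (cong c (sym (+-suc a k)))

  arc-positions : ∀ a k → All (λ w → ∃ λ t → a < t × t ≤ a + k × w ≡ c t) (arc a k)
  arc-positions a zero    = []
  arc-positions a (suc k) =
    (suc a , ≤-refl , subst (suc a ≤_) (sym (+-suc a k)) (s≤s (m≤m+n a k)) , refl)
    ∷ All.map (λ { (t , a<t , t≤ , eq) → t , <⇒≤ a<t , subst (t ≤_) (sym (+-suc a k)) t≤ , eq })
              (arc-positions (suc a) k)

  arc-OnCycle : ∀ a k → All OnCycle (c a ∷ arc a k)
  arc-OnCycle a k = (clamp m a , refl) ∷ All.map (λ { (t , _ , _ , eq) → clamp m t , sym eq }) (arc-positions a k)

  Unique-arc : ∀ a k → a + k ≤ m → Unique (c a ∷ arc a k)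
  Unique-arc a zero    _     = [] ∷ []
  Unique-arc a (suc k) a+k≤m =
    All.map (λ { (t , a<t , t≤ , eq) ca≡w →
                 <-irrefl (c-injective (≤-trans (m≤m+n a (suc k)) a+k≤m) (≤-trans t≤ a+k≤m) (trans ca≡w eq)) a<t })
            (arc-positions a (suc k))
    ∷ Unique-arc (suc a) k (subst (_≤ m) (+-suc a k) a+k≤m)

  -- The closed walk c a, c (a + 1), …, c (a + suc k), Q, c a is a simple cycle sharing the edge
  -- c a — c (a + 1) with C, so it has the same edges as C; in particular its closing edge.
  detour-closing : ∀ a k → a + suc k ≤ m → ∀ Q → All (¬_ ∘ OnCycle) Q → Unique Q →
                   Walk (c (a + suc k) ∷ Q ++ [ c a ]) → 3 ≤ length (c a ∷ arc a (suc k) ++ Q) →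
                   CycleEdge C (lastOf (c a) (arc a (suc k) ++ Q)) (c a)
  detour-closing a k b≤m Q off Q! walk long =
    Equivalence.from (cactus C D (c a) (c (suc a)) (c-CycleEdge a a<m) (closedWalk⇒Cycle-first _ _ _ long D! closed) _ _)
      (closedWalk⇒Cycle-closing _ _ long D! closed)
    where
    a<m : a < m
    a<m = <-≤-trans (m<m+n a (s≤s z≤n)) b≤m
    D! : Unique (c a ∷ arc a (suc k) ++ Q)
    D! = Uniqueₚ.++⁺ (Unique-arc a (suc k) b≤m) Q!
           λ (w∈arc , w∈Q) → All.lookup off w∈Q (All.lookup (arc-OnCycle a (suc k)) w∈arc)
    closed : ClosedWalk (c a ∷ arc a (suc k) ++ Q)
    closed = subst (λ xs → Walk (c a ∷ xs)) (sym (++-assoc (arc a (suc k)) Q [ c a ]))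
               (Walk-++ (c a) (arc a (suc k)) (Q ++ [ c a ]) (Walk-arc a (suc k) b≤m)
                 (subst (λ w → Walk (w ∷ Q ++ [ c a ])) (sym (lastOf-arc a (suc k))) walk))
    D : Cycle G
    D = closedWalk⇒Cycle _ long D! closed

  closing-not-CycleEdge : ∀ a k Q → All (¬_ ∘ OnCycle) Q → Q ≢ [] ⊎ ¬ CycleEdge C (c (a + suc k)) (c a) →
                          ¬ CycleEdge C (lastOf (c a) (arc a (suc k) ++ Q)) (c a)
  closing-not-CycleEdge a k []      _   (inj₁ Q≢[]) _ = Q≢[] refl
  closing-not-CycleEdge a k []      _   (inj₂ ¬edge) edge =
    ¬edge (subst (λ w → CycleEdge C w (c a))
                 (trans (cong (lastOf (c a)) (++-identityʳ (arc a (suc k)))) (lastOf-arc a (suc k))) edge)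
  closing-not-CycleEdge a k (q ∷ Q) off _ edge =
    All.lookup off (lastOf-∈ q Q)
      (CycleEdge⇒OnCycle (subst (λ w → CycleEdge C w (c a)) (lastOf-++-∷ (c a) (arc a (suc k)) q Q) edge))

  noShortcut-positions : ∀ a k → a + suc k ≤ m → ∀ Q → All (¬_ ∘ OnCycle) Q → Unique Q →
                         Walk (c (a + suc k) ∷ Q ++ [ c a ]) → Q ≢ [] ⊎ ¬ CycleEdge C (c (a + suc k)) (c a) → ⊥
  noShortcut-positions a zero    b≤m []      _   _  _    (inj₁ Q≢[]) = Q≢[] refl
  noShortcut-positions a zero    b≤m []      _   _  _    (inj₂ ¬edge) =
    ¬edge (CycleEdge-sym (subst (λ t → CycleEdge C (c a) (c t)) (+-comm 1 a) (c-CycleEdge a (subst (_≤ m) (+-comm a 1) b≤m))))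
  noShortcut-positions a zero    b≤m (q ∷ Q) off Q! walk hyp =
    closing-not-CycleEdge a zero (q ∷ Q) off hyp (detour-closing a zero b≤m (q ∷ Q) off Q! walk (s≤s (s≤s (s≤s z≤n))))
  noShortcut-positions a (suc k) b≤m Q       off Q! walk hyp =
    closing-not-CycleEdge a (suc k) Q off hyp (detour-closing a (suc k) b≤m Q off Q! walk (s≤s (s≤s (s≤s z≤n))))

  noShortcut-descending : ∀ i j → toℕ i < toℕ j → ∀ Q → All (¬_ ∘ OnCycle) Q → Unique Q →
                          Walk (vtx C j ∷ Q ++ [ vtx C i ]) → Q ≢ [] ⊎ ¬ CycleEdge C (vtx C j) (vtx C i) → ⊥
  noShortcut-descending i j i<j Q off Q! walk hyp =
    noShortcut-positions (toℕ i) k b≤m Q off Q!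
      (subst₂ (λ u w → Walk (u ∷ Q ++ [ w ])) vtxj≡c (vtx≡c i) walk)
      (Sum.map₂ (λ ¬edge → ¬edge ∘ subst₂ (CycleEdge C) (sym vtxj≡c) (sym (vtx≡c i))) hyp)
    where
    k = toℕ j ∸ suc (toℕ i)
    b≡j : toℕ i + suc k ≡ toℕ j
    b≡j = trans (+-suc (toℕ i) k) (m+[n∸m]≡n i<j)
    b≤m : toℕ i + suc k ≤ m
    b≤m = subst (_≤ m) (sym b≡j) (Finₚ.toℕ≤pred[n] j)
    vtxj≡c : vtx C j ≡ c (toℕ i + suc k)
    vtxj≡c = trans (vtx≡c j) (cong c (sym b≡j))

  -- A walk between two distinct cycle vertices whose interior avoids C is a single edge of C.
  noShortcut : ∀ i j → i ≢ j → ∀ Q → All (¬_ ∘ OnCycle) Q → Unique Q →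
               Walk (vtx C i ∷ Q ++ [ vtx C j ]) → Q ≢ [] ⊎ ¬ CycleEdge C (vtx C i) (vtx C j) → ⊥
  noShortcut i j i≢j Q off Q! walk hyp with Finₚ.<-cmp i j
  ... | tri≈ _ i≡j _ = i≢j i≡j
  ... | tri> _ _ j<i = noShortcut-descending j i j<i Q off Q! walk hyp
  ... | tri< i<j _ _ =
    noShortcut-descending i j i<j (reverse Q) (All-reverse⁺ off) (Unique-reverse⁺ Q!)
      (subst Walk (reverse-∷-++-[] (vtx C i) Q (vtx C j)) (Walk-reverse _ walk))
      (Sum.map (λ Q≢[] → Q≢[] ∘ reverse-injective) (λ ¬edge → ¬edge ∘ CycleEdge-sym) hyp)

  noChord : ∀ i j → i ≢ j → Adj G (vtx C i) (vtx C j) → CycleEdge C (vtx C i) (vtx C j)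
  noChord i j i≢j adj with cycleEdge? (vtx C i) (vtx C j)
  ... | yes edge = edge
  ... | no ¬edge = ⊥-elim (noShortcut i j i≢j [] [] [] (adj , tt) (inj₂ ¬edge))

  noReturn : ∀ i x xs → ¬ OnCycle x → Walk (vtx C i ∷ x ∷ xs) → Unique (vtx C i ∷ x ∷ xs) → ¬ Any OnCycle xs
  noReturn i x xs off (ix , walk) (i∉ ∷ x∉ ∷ xs!) returns with firstSplit onCycle? returns
  ... | firstAt pre e post refl none (k , refl) =
    noShortcut i k i≢k (x ∷ pre) (off ∷ none) (Allₚ.++⁻ˡ pre x∉ ∷ Unique-++⁻ˡ pre _ xs!)
      (Walk-prefix (vtx C i ∷ x ∷ pre) (vtx C k) post (ix , walk)) (inj₁ λ ())
    where
    i≢k : i ≢ k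
    i≢k refl = All.lookup i∉ (there (∈-++⁺ʳ pre (here refl))) refl

  -- Along a simple walk starting on C, the cycle vertices are reached by steps along C,
  -- so they stay in any set of positions closed under such steps avoiding x and z.
  module Confined (Inv : Fin (suc m) → Set) (x z : Fin (suc m))
                  (forward  : ∀ q → Inv q → next q ≢ x → next q ≢ z → Inv (next q))
                  (backward : ∀ q → Inv (next q) → q ≢ x → q ≢ z → Inv q) where

    confined : ∀ i xs → Inv i → Walk (vtx C i ∷ xs) → Unique (vtx C i ∷ xs) →
               vtx C x ∉ xs → vtx C z ∉ xs → ∀ j → vtx C j ∈ xs → Inv j
    confined i (y ∷ ys) inv (iy , walk) i∷ys!@(i∉ ∷ ys!) x∉ z∉ j j∈ with onCycle? y
    ... | no off = ⊥-elim (noReturn i y ys off (iy , walk) i∷ys! (returns j∈))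
      where
      returns : vtx C j ∈ y ∷ ys → Any OnCycle ys
      returns (here j≡y)   = ⊥-elim (off (j , j≡y))
      returns (there j∈ys) = lose j∈ys (j , refl)
    ... | yes (k , refl) = continue j∈
      where
      k≢ : ∀ {w} → vtx C w ∉ vtx C k ∷ ys → ∀ {q} → q ≡ k → q ≢ w
      k≢ w∉ refl refl = w∉ (here refl)
      i≢k : i ≢ k
      i≢k refl = All.lookup i∉ (here refl) refl
      inv-k : Inv k
      inv-k with CycleEdge-indices (noChord i k i≢k iy)
      ... | inj₁ k≡next = subst Inv (sym k≡next) (forward i inv (k≢ x∉ (sym k≡next)) (k≢ z∉ (sym k≡next)))
      ... | inj₂ i≡next = backward k (subst Inv i≡next inv) (k≢ x∉ refl) (k≢ z∉ refl)
      continue : vtx C j ∈ vtx C k ∷ ys → Inv j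
      continue (here j≡k)   = subst Inv (inj C (sym j≡k)) inv-k
      continue (there j∈ys) = confined k ys inv-k walk ys! (x∉ ∘ there) (z∉ ∘ there) j j∈ys

  open FirstSplit

  sameEntry : ∀ {r ts₁ ts₂} → Walk (r ∷ ts₁) → Unique (r ∷ ts₁) → Walk (r ∷ ts₂) → Unique (r ∷ ts₂) →
              (s₁ : FirstSplit OnCycle (r ∷ ts₁)) (s₂ : FirstSplit OnCycle (r ∷ ts₂)) → found s₁ ≡ found s₂
  sameEntry _ _ _ _ (firstAt [] _ _ eq₁ _ _) (firstAt [] _ _ eq₂ _ _) = trans (sym (∷-injectiveˡ eq₁)) (∷-injectiveˡ eq₂)
  sameEntry _ _ _ _ (firstAt [] _ _ eq₁ _ on₁) (firstAt (_ ∷ _) _ _ eq₂ (off ∷ _) _) =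
    ⊥-elim (off (subst OnCycle (trans (sym (∷-injectiveˡ eq₁)) (∷-injectiveˡ eq₂)) on₁))
  sameEntry _ _ _ _ (firstAt (_ ∷ _) _ _ eq₁ (off ∷ _) _) (firstAt [] _ _ eq₂ _ on₂) =
    ⊥-elim (off (subst OnCycle (trans (sym (∷-injectiveˡ eq₂)) (∷-injectiveˡ eq₁)) on₂))
  sameEntry w₁ u₁ w₂ u₂ (firstAt (b₁ ∷ bs₁) _ post₁ eq₁ none₁ (i₁ , refl))
                        (firstAt (b₂ ∷ bs₂) _ post₂ eq₂ none₂ (i₂ , refl))
    with vtx C i₁ Fin.≟ vtx C i₂
  ... | yes same = same
  ... | no different with meetingWalk (vtx C i₁) (vtx C i₂) (reverse (b₁ ∷ bs₁)) (reverse (b₂ ∷ bs₂))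
                            (Walk-reverse-prefix (b₁ ∷ bs₁) _ post₁ (subst Walk eq₁ w₁))
                            (Walk-reverse-prefix (b₂ ∷ bs₂) _ post₂ (subst Walk eq₂ w₂))
                            (Unique-reverse⁺ (Unique-++⁻ˡ (b₁ ∷ bs₁) _ (subst Unique eq₁ u₁)))
                            (Unique-reverse⁺ (Unique-++⁻ˡ (b₂ ∷ bs₂) _ (subst Unique eq₂ u₂)))
                            (Anyₚ.reverse⁺ {xs = b₁ ∷ bs₁} (here (∷-injectiveˡ eq₁)))
                            (Anyₚ.reverse⁺ {xs = b₂ ∷ bs₂} (here (∷-injectiveˡ eq₂)))
                            (All-reverse⁺ none₁) (All-reverse⁺ none₂)
  ... | Q , Q≢[] , Q! , off , walk = ⊥-elim (noShortcut i₁ i₂ (different ∘ cong (vtx C)) Q off Q! walk (inj₁ Q≢[]))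

  module _ (S : Fin n → Set) (r : Fin n) where

    Reach : Fin (suc m) → Fin (suc m) → Set
    Reach pe t = t ≢ pe × S (vtx C t) ×
                 ∃ λ post → Walk (vtx C pe ∷ post) × Unique (vtx C pe ∷ post) ×
                            vtx C t ∈ post × (∀ {w} → w ∈ post → S w → w ≡ vtx C t)

    trapped : ∀ (Inv : Fin (suc m) → Set) x z →
              (∀ q → Inv q → next q ≢ x → next q ≢ z → Inv (next q)) →
              (∀ q → Inv (next q) → q ≢ x → q ≢ z → Inv q) →
              ∀ {pe t} → Inv pe → S (vtx C x) → S (vtx C z) → t ≢ x → t ≢ z → Reach pe t → Inv t
    trapped Inv x z forward backward inv Sx Sz t≢x t≢z (_ , _ , post , walk , u , t∈ , onlyT) =
      Confined.confined Inv x z forward backward _ post inv walk u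
        (λ x∈ → t≢x (sym (inj C (onlyT x∈ Sx)))) (λ z∈ → t≢z (sym (inj C (onlyT z∈ Sz)))) _ t∈

    trappedBetween : ∀ {pe x z t} → Between x z pe → S (vtx C x) → S (vtx C z) → t ≢ x → t ≢ z →
                     Reach pe t → Between x z t
    trappedBetween {x = x} {z} =
      trapped (Between x z) x z (λ q b _ nz → Between-next x z q b nz) (λ q b nx _ → Between-prev x z q b nx)

    trappedOutside : ∀ {pe x z t} → Outside x z pe → S (vtx C x) → S (vtx C z) → t ≢ x → t ≢ z →
                     Reach pe t → Outside x z t
    trappedOutside {x = x} {z} =
      trapped (Outside x z) x z (λ q o nx _ → Outside-next x z q o nx) (λ q o _ nz → Outside-prev x z q o nz)

    threeTargets : ∀ {pe x y z} → x Fin.< y → y Fin.< z → Reach pe x → Reach pe y → Reach pe z → ⊥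
    threeTargets {pe} {x} {y} {z} x<y y<z rx@(_ , Sx , _) ry@(_ , Sy , _) rz@(_ , Sz , _) =
      cases (Finₚ.<-cmp pe x) (Finₚ.<-cmp pe y) (Finₚ.<-cmp pe z)
      where
      x<z = <-trans x<y y<z
      outside : Outside x z pe → ⊥
      outside o = Sum.[ <-asym x<y , <-asym y<z ]′ (trappedOutside o Sx Sz (Finₚ.<⇒≢ x<y ∘ sym) (Finₚ.<⇒≢ y<z) ry)
      cases : Tri (pe Fin.< x) (pe ≡ x) (x Fin.< pe) → Tri (pe Fin.< y) (pe ≡ y) (y Fin.< pe) →
              Tri (pe Fin.< z) (pe ≡ z) (z Fin.< pe) → ⊥
      cases (tri≈ _ pe≡x _) _ _ = proj₁ rx (sym pe≡x)
      cases _ (tri≈ _ pe≡y _) _ = proj₁ ry (sym pe≡y)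
      cases _ _ (tri≈ _ pe≡z _) = proj₁ rz (sym pe≡z)
      cases (tri< pe<x _ _) _ _ = outside (inj₁ pe<x)
      cases _ _ (tri> _ _ z<pe) = outside (inj₂ z<pe)
      cases (tri> _ _ x<pe) (tri< pe<y _ _) _ =
        <-asym y<z (proj₂ (trappedBetween (x<pe , pe<y) Sx Sy (Finₚ.<⇒≢ x<z ∘ sym) (Finₚ.<⇒≢ y<z ∘ sym) rz))
      cases _ (tri> _ _ y<pe) (tri< pe<z _ _) =
        <-asym x<y (proj₁ (trappedBetween (y<pe , pe<z) Sy Sz (Finₚ.<⇒≢ x<y) (Finₚ.<⇒≢ x<z) rx))

    onlyEnd : ∀ {ts a w} → All (¬_ ∘ S) (r ∷ ts) → w ∈ r ∷ ts ++ [ a ] → S w → w ≡ a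
    onlyEnd {ts} ok w∈ Sw with ∈-++⁻ (r ∷ ts) w∈
    ... | inj₁ w∈ts       = ⊥-elim (All.lookup ok w∈ts Sw)
    ... | inj₂ (here w≡a) = w≡a

    found-∈ : ∀ {P : Fin n → Set} {xs} (s : FirstSplit P xs) → found s ∈ xs
    found-∈ (firstAt pre _ _ eq _ _) = subst (_ ∈_) (sym eq) (∈-++⁺ʳ pre (here refl))

    notEntry : ∀ {t t′ ts′} → t′ ≢ t → S (vtx C t) → All (¬_ ∘ S) (r ∷ ts′) →
               (s′ : FirstSplit OnCycle (r ∷ ts′ ++ [ vtx C t′ ])) → found s′ ≢ vtx C t
    notEntry t′≢t St ok′ s′ found≡t =
      t′≢t (inj C (sym (trans (sym found≡t) (onlyEnd ok′ (found-∈ s′) (subst S (sym found≡t) St)))))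

    reach : ∀ {pe t ts} → S (vtx C t) → Walk (r ∷ ts ++ [ vtx C t ]) → Unique (r ∷ ts ++ [ vtx C t ]) →
            All (¬_ ∘ S) (r ∷ ts) → (s : FirstSplit OnCycle (r ∷ ts ++ [ vtx C t ])) → found s ≡ vtx C pe →
            t ≢ pe → Reach pe t
    reach {pe} {t} {ts} St walk walk! ok (firstAt pre _ post eq none _) refl t≢pe =
      t≢pe , St , post ,
      Walk-suffix pre _ post (subst Walk eq walk) ,
      Unique-++⁻ʳ pre _ (subst Unique eq walk!) ,
      t∈post (∈-++⁻ pre (subst (vtx C t ∈_) eq (∈-++⁺ʳ (r ∷ ts) (here refl)))) ,
      λ w∈ Sw → onlyEnd ok (subst (_ ∈_) (sym eq) (∈-++⁺ʳ pre (there w∈))) Sw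
      where
      t∈post : vtx C t ∈ pre ⊎ vtx C t ∈ vtx C pe ∷ post → vtx C t ∈ post
      t∈post (inj₁ t∈pre)         = ⊥-elim (All.lookup none t∈pre (t , refl))
      t∈post (inj₂ (here t≡pe))   = ⊥-elim (t≢pe (inj C t≡pe))
      t∈post (inj₂ (there t∈))    = t∈

    Exposed : Fin (suc m) → Set
    Exposed t = S (vtx C t) × Unblocked S r (vtx C t)

    atMostTwoExposed : ∀ i j k → i ≢ j → j ≢ k → i ≢ k → Exposed i → Exposed j → ¬ Exposed k
    atMostTwoExposed i j k i≢j j≢k i≢k (Si , tsi , wi , ui , oki) (Sj , tsj , wj , uj , okj) (Sk , tsk , wk , uk , okk) =
      sort3 (Reach pe) threeTargets i≢j j≢k i≢k
        (reach Si wi ui oki si entry-i (λ i≡pe → notEntry (i≢j ∘ sym) Si okj sj (trans entry-j (at i≡pe))))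
        (reach Sj wj uj okj sj entry-j (λ j≡pe → notEntry i≢j Sj oki si (trans entry-i (at j≡pe))))
        (reach Sk wk uk okk sk entry-k (λ k≡pe → notEntry i≢k Sk oki si (trans entry-i (at k≡pe))))
      where
      entry : ∀ ts t → FirstSplit OnCycle (r ∷ ts ++ [ vtx C t ])
      entry ts t = firstSplit onCycle? (lose (∈-++⁺ʳ (r ∷ ts) (here refl)) (t , refl))
      si = entry tsi i
      sj = entry tsj j
      sk = entry tsk k
      pe = proj₁ (holds si)
      entry-i : found si ≡ vtx C pe
      entry-i = sym (proj₂ (holds si))
      entry-j : found sj ≡ vtx C pe
      entry-j = trans (sym (sameEntry wi ui wj uj si sj)) entry-i
      entry-k : found sk ≡ vtx C pe
      entry-k = trans (sym (sameEntry wi ui wk uk si sk)) entry-i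
      at : ∀ {t} → t ≡ pe → vtx C pe ≡ vtx C t
      at t≡pe = cong (vtx C) (sym t≡pe)

-- The spread of the fire

¬T⇒≡false : ∀ {b} → ¬ T b → b ≡ false
¬T⇒≡false {false} _  = refl
¬T⇒≡false {true}  ¬t = ⊥-elim (¬t tt)

isBy-mono : ∀ m {a b} → T (isBy m a) → a ≤ b → T (isBy m b)
isBy-mono (just j) {a} by a≤b = ≤⇒≤ᵇ (≤-trans (≤ᵇ⇒≤ j a by) a≤b)

isAt⇒≡ : ∀ m i → T (isAt m i) → m ≡ just i
isAt⇒≡ (just j) i at with Equivalence.to T-∧ at
... | j≤i , i≤j = cong just (≤-antisym (≤ᵇ⇒≤ j i j≤i) (≤ᵇ⇒≤ i j i≤j))

module Fire {n : ℕ} (G : Graph n) (r : Fin n) where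
  open Walks G

  Burning : Strategy n → ℕ → Fin n → Set
  Burning p i v = T (burning G r p i v)

  spreads : Strategy n → ℕ → Fin n → Bool
  spreads p i v = any (λ u → burning G r p i u ∧ adj G u v) (allFin n)

  Catches : Strategy n → ℕ → Fin n → Set
  Catches p i v = ¬ T (isBy (p v) (suc i)) × ∃ λ u → Burning p i u × Adj G u v

  burning-source : ∀ p → Burning p 0 r
  burning-source p with r Fin.≟ r
  ... | yes _   = tt
  ... | no r≢r = r≢r refl

  burning-zero : ∀ {p u} → Burning p 0 u → r ≡ u
  burning-zero {u = u} b with r Fin.≟ u
  ... | yes r≡u = r≡u

  burning-suc⁻ : ∀ {p i v} → Burning p (suc i) v → Burning p i v ⊎ Catches p i v
  burning-suc⁻ {p} {i} {v} b with Equivalence.to T-∨ b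
  ... | inj₁ old    = inj₁ old
  ... | inj₂ spread with Equivalence.to T-∧ spread
  ... | unprotected , near with Any.satisfied (Anyₚ.any⁻ _ (allFin n) near)
  ... | u , u-burns-adj = inj₂ (subst T (Equivalence.to T-not-≡ unprotected) , u , Equivalence.to T-∧ u-burns-adj)

  burning-suc⁺ : ∀ {p i v} → Burning p i v ⊎ Catches p i v → Burning p (suc i) v
  burning-suc⁺ (inj₁ old) = Equivalence.from T-∨ (inj₁ old)
  burning-suc⁺ (inj₂ (unprotected , u , bu , uv)) =
    Equivalence.from T-∨ (inj₂ (Equivalence.from T-∧ (Equivalence.from T-not-≡ (¬T⇒≡false unprotected) ,
      Anyₚ.any⁺ _ (lose (∈-allFin u) (Equivalence.from T-∧ (bu , uv))))))

  burning-suc : ∀ {p i v} → Burning p i v → Burning p (suc i) v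
  burning-suc {p} {i} {v} = burning-suc⁺ {p} {i} {v} ∘ inj₁

  burning-mono : ∀ {p i j v} → i ≤ j → Burning p i v → Burning p j v
  burning-mono i≤j = go (≤⇒≤′ i≤j)
    where
    go : ∀ {p i j v} → i ≤′ j → Burning p i v → Burning p j v
    go ≤′-refl        b = b
    go {p} (≤′-step {n = j} i≤′j) b = burning-suc {p} {j} (go i≤′j b)

  neverBurns : ∀ {p v k} → p v ≡ just (suc k) → ¬ Burning p k v → ∀ i → ¬ Burning p i v
  neverBurns {k = k} pv ¬bk i b with i ≤? k
  ... | yes i≤k = ¬bk (burning-mono i≤k b)
  neverBurns pv ¬bk zero b | no i≰k = i≰k z≤n
  neverBurns {p} {v} pv ¬bk (suc i) b | no i≰k with burning-suc⁻ {p} {i} b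
  ... | inj₁ old                = neverBurns pv ¬bk i old
  ... | inj₂ (unprotected , _) =
    unprotected (subst (λ m → T (isBy m (suc i))) (sym pv) (≤⇒≤ᵇ (≰⇒> i≰k)))

  protected-safe : ∀ {f p v} → Valid G r f p → Protected p v → ∀ i → ¬ Burning p i v
  protected-safe {v = v} (placed , _) (j , pv) with placed v j pv
  ... | k , refl , ¬bk = neverBurns pv (subst T ¬bk)

  burningWalk : ∀ {p} t {u} → Burning p t u →
                ∃ λ xs → lastOf r xs ≡ u × Walk (r ∷ xs) × Unique (r ∷ xs) × All (Burning p t) (r ∷ xs)
  burningWalk {p} zero b with burning-zero {p} b
  ... | refl = [] , refl , tt , [] ∷ [] , b ∷ []
  burningWalk {p} (suc t) {u} b with T? (burning G r p t u)
  ... | yes old with burningWalk t old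
  ...   | xs , last , walk , xs! , burn = xs , last , walk , xs! , All.map (burning-suc {p} {t}) burn
  burningWalk {p} (suc t) {u} b | no ¬old with burning-suc⁻ {p} {t} b
  ... | inj₁ old = ⊥-elim (¬old old)
  ... | inj₂ (_ , w , bw , wu) with burningWalk t bw
  ...   | xs , last , walk , xs! , burn =
          xs ++ [ u ] , lastOf-++-∷ r xs u [] ,
          Walk-++ r xs [ u ] walk (subst (λ x → Adj G x u) (sym last) wu , tt) ,
          Unique-∷ʳ⁺ xs! (¬old ∘ All.lookup burn) ,
          Allₚ.++⁺ (All.map (burning-suc {p} {t}) burn) (b ∷ [])

  Quiescent : Strategy n → ℕ → Set
  Quiescent p j = ∀ {v} → Burning p (suc j) v → Burning p j v

  quiescent-forever : ∀ {p j} → Quiescent p j → ∀ d {v} → Burning p (d + j) v → Burning p j v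
  quiescent-forever st zero    b = b
  quiescent-forever {p} {j} st (suc d) {v} b with burning-suc⁻ {p} {d + j} b
  ... | inj₁ old = quiescent-forever {p} {j} st d old
  ... | inj₂ (unprotected , u , bu , uv) =
    st (burning-suc⁺ {p} {j} (inj₂ ((λ by → unprotected (isBy-mono (p v) by (s≤s (m≤n+m j d)))) ,
                                   u , quiescent-forever {p} {j} st d bu , uv)))

  burnedCount : Strategy n → ℕ → ℕ
  burnedCount p k = length (filterᵇ (burning G r p k) (allFin n))

  stabilises-or-grows : ∀ p k → (∃ λ j → j < k × Quiescent p j) ⊎ suc k ≤ burnedCount p k
  stabilises-or-grows p zero = inj₂ (filter-some (T? ∘ burning G r p 0) (lose (∈-allFin r) (burning-source p)))
  stabilises-or-grows p (suc k) with stabilises-or-grows p k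
  ... | inj₁ (j , j<k , st) = inj₁ (j , m<n⇒m<1+n j<k , st)
  ... | inj₂ grown with Finₚ.any? (λ v → T? (burning G r p (suc k) v) ×-dec ¬? (T? (burning G r p k v)))
  ...   | yes (v , new , ¬old) =
    inj₂ (≤-trans (s≤s grown) (length-filterᵇ-mono-< _ _ (burning-suc {p} {k}) (∈-allFin v) new ¬old))
  ...   | no  none             = inj₁ (k , ≤-refl , λ {v} b → decidable-stable (T? _) (λ ¬old → none (v , b , ¬old)))

  burning-stabilises : ∀ {p i v} → Burning p i v → Burning p n v
  burning-stabilises {p} {i} b with stabilises-or-grows p n
  ... | inj₂ grown =
    ⊥-elim (n≮n n (≤-trans grown (≤-trans (length-filter _ (allFin n)) (≤-reflexive (length-tabulate id)))))
  ... | inj₁ (j , j<n , st) = burning-mono {p} (<⇒≤ j<n) (quiescent-forever {p} {j} st i (burning-mono {p} (m≤m+n i j) b))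

  unburnt⇒saved : ∀ {p v} → ¬ Burning p n v → Saved G r p v
  unburnt⇒saved {p} ¬bn i = ¬T⇒≡false (¬bn ∘ burning-stabilises {p} {i})

  threatened : Strategy n → Fin n → Bool
  threatened p v = spreads p n v

  prune : Strategy n → Strategy n
  prune p v = if threatened p v then p v else nothing

  prune-cases : ∀ p v → (prune p v ≡ p v × T (threatened p v)) ⊎ (prune p v ≡ nothing × ¬ T (threatened p v))
  prune-cases p v with threatened p v
  ... | true  = inj₁ (refl , tt)
  ... | false = inj₂ (refl , id)

  prune-just : ∀ {p v j} → prune p v ≡ just j → p v ≡ just j × T (threatened p v)
  prune-just {p} {v} eq with prune-cases p v
  ... | inj₁ (same , th) = trans (sym same) eq , th
  ... | inj₂ (none , _)  with () ← trans (sym none) eq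

  unthreatened-no-spread : ∀ {p v} → ¬ T (threatened p v) → ∀ i → spreads p i v ≡ false
  unthreatened-no-spread {p} {v} ¬th i =
    ¬T⇒≡false λ near → ¬th (Anyₚ.any⁺ _ (Any.map stabilise (Anyₚ.any⁻ _ (allFin n) near)))
    where
    stabilise : ∀ {u} → T (burning G r p i u ∧ adj G u v) → T (burning G r p n u ∧ adj G u v)
    stabilise bu∧uv with Equivalence.to T-∧ bu∧uv
    ... | bu , uv = Equivalence.from T-∧ (burning-stabilises {p} {i} bu , uv)

  spreads-cong : ∀ {p q i v} → (∀ u → burning G r p i u ≡ burning G r q i u) → spreads p i v ≡ spreads q i v
  spreads-cong {v = v} same = cong or (map-cong (λ u → cong (_∧ adj G u v) (same u)) (allFin n))

  burning-prune : ∀ p i v → burning G r (prune p) i v ≡ burning G r p i v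
  burning-prune p zero v with r Fin.≟ v
  ... | yes _ = refl
  ... | no  _ = refl
  burning-prune p (suc i) v =
    cong₂ _∨_ (burning-prune p i v)
      (trans (cong (not (isBy (prune p v) (suc i)) ∧_) (spreads-cong {prune p} {p} {i} {v} (burning-prune p i))) guard)
    where
    guard : not (isBy (prune p v) (suc i)) ∧ spreads p i v ≡ not (isBy (p v) (suc i)) ∧ spreads p i v
    guard with prune-cases p v
    ... | inj₁ (same , _)  = cong (λ m → not (isBy m (suc i)) ∧ spreads p i v) same
    ... | inj₂ (none , ¬th) rewrite none | unthreatened-no-spread {p} ¬th i = sym (∧-zeroʳ _)

  prune-protected : ∀ {p v} → Protected (prune p) v → Protected p v
  prune-protected (j , eq) = j , proj₁ (prune-just eq)

  placedAt-prune : ∀ p i → placedAt (prune p) i ≤ placedAt p i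
  placedAt-prune p i = length-filterᵇ-mono _ _ at (allFin n)
    where
    at : ∀ {v} → T (isAt (prune p v) i) → T (isAt (p v) i)
    at {v} t = subst (λ m → T (isAt m i)) (trans placed (sym (proj₁ (prune-just placed)))) t
      where placed = isAt⇒≡ (prune p v) i t

  prune-valid : ∀ {f p} → Valid G r f p → Valid G r f (prune p)
  prune-valid {p = p} (placed , budget) =
    (λ v j eq → let k , j≡ , ¬bk = placed v j (proj₁ (prune-just eq)) in k , j≡ , trans (burning-prune p k v) ¬bk) ,
    (λ i → ≤-trans (placedAt-prune p i) (budget i))

  prune-saves : ∀ {p k} → SavesAtLeast G r p k → SavesAtLeast G r (prune p) k
  prune-saves {p} (vs , len , vs! , saved) = vs , len , vs! , All.map (λ {v} s i → trans (burning-prune p i v) (s i)) saved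

  prune-unblocked : ∀ {f p a} → Valid G r f p → Protected (prune p) a → Unblocked (Protected (prune p)) r a
  prune-unblocked {p = p} {a} valid prot with Any.satisfied (Anyₚ.any⁻ _ (allFin n) (proj₂ (prune-just (proj₂ prot))))
  ... | u , bu∧ua with Equivalence.to T-∧ bu∧ua
  ... | bu , ua with burningWalk {p} n bu
  ... | xs , last , walk , xs! , burn =
    xs ,
    Walk-++ r xs [ a ] walk (subst (λ x → Adj G x a) (sym last) ua , tt) ,
    Unique-∷ʳ⁺ xs! (λ a∈ → protected-safe valid (prune-protected prot) n (All.lookup burn a∈)) ,
    All.map (λ bw pw → protected-safe valid (prune-protected pw) n bw) burn

  prune-bounded : ∀ {f p v j} → Valid G r f p → prune p v ≡ just j → j ≤ suc n
  prune-bounded {p = p} {v} {j} valid eq with prune-just eq | j ≤? suc n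
  ... | _ , _ | yes j≤ = j≤
  ... | pv , th | no j≰ with Any.satisfied (Anyₚ.any⁻ _ (allFin n) th)
  ...   | u , bu∧uv = ⊥-elim (protected-safe valid (j , pv) (suc n)
                        (burning-suc⁺ {p} {n} (inj₂ (late , u , Equivalence.to T-∧ bu∧uv))))
    where
    late : ¬ T (isBy (p v) (suc n))
    late by = j≰ (≤ᵇ⇒≤ j (suc n) (subst (λ m → T (isBy m (suc n))) pv by))

-- Existence of optimal strategies

options : ℕ → List (Maybe ℕ)
options N = nothing ∷ map just (upTo (suc N))

∈-options : ∀ {N} m → (∀ {j} → m ≡ just j → j ≤ N) → m ∈ options N
∈-options nothing  _     = here refl
∈-options (just j) bound = there (∈-map⁺ just (∈-upTo⁺ (s≤s (bound refl))))

options-bound : ∀ {N m j} → m ∈ options N → m ≡ just j → j ≤ N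
options-bound (here refl) ()
options-bound (there m∈)  refl with ∈-map⁻ just m∈
... | _ , j∈ , refl = ≤-pred (∈-upTo⁻ j∈)

module Optimum {n : ℕ} (G : Graph n) (r : Fin n) (f : ℕ → ℕ) where
  open Fire G r

  savedCount : Strategy n → ℕ
  savedCount p = length (filterᵇ (λ v → not (burning G r p n v)) (allFin n))

  savesAtLeast⇒≤ : ∀ {p k} → SavesAtLeast G r p k → k ≤ savedCount p
  savesAtLeast⇒≤ {p} (vs , refl , vs! , saved) = Unique-length-≤ vs _ vs! λ {v} v∈ →
    ∈-filter⁺ (T? ∘ λ v → not (burning G r p n v)) (∈-allFin v) (Equivalence.from T-not-≡ (All.lookup saved v∈ n))

  ≤⇒savesAtLeast : ∀ {p k} → k ≤ savedCount p → SavesAtLeast G r p k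
  ≤⇒savesAtLeast {p} {k} k≤ =
    take k unburnt , trans (length-take k unburnt) (m≤n⇒m⊓n≡m k≤) ,
    Uniqueₚ.take⁺ k (Uniqueₚ.filter⁺ _ (Uniqueₚ.allFin⁺ n)) ,
    Allₚ.take⁺ k (All.tabulate λ v∈ →
      unburnt⇒saved {p} (subst T (Equivalence.to T-not-≡ (proj₂ (∈-filter⁻ _ {xs = allFin n} v∈)))))
    where unburnt = filterᵇ (λ v → not (burning G r p n v)) (allFin n)

  savedCount-prune : ∀ p → savedCount (prune p) ≡ savedCount p
  savedCount-prune p = cong length (filterᵇ-cong (λ v → cong not (burning-prune p n v)) (allFin n))

  module _ {p q : Strategy n} (p≗q : ∀ v → p v ≡ q v) where

    burning-cong : ∀ i v → burning G r p i v ≡ burning G r q i v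
    burning-cong zero v with r Fin.≟ v
    ... | yes _ = refl
    ... | no  _ = refl
    burning-cong (suc i) v =
      cong₂ _∨_ (burning-cong i v)
        (cong₂ (λ m b → not (isBy m (suc i)) ∧ b) (p≗q v) (spreads-cong {p} {q} {i} {v} (burning-cong i)))

    valid-cong : Valid G r f p → Valid G r f q
    valid-cong (placed , budget) =
      (λ v j eq → let k , j≡ , ¬bk = placed v j (trans (p≗q v) eq) in k , j≡ , trans (sym (burning-cong k v)) ¬bk) ,
      (λ i → subst (_≤ f i) (cong length (filterᵇ-cong (λ v → cong (λ m → isAt m i) (p≗q v)) (allFin n))) (budget i))

    savedCount-cong : savedCount p ≡ savedCount q
    savedCount-cong = cong length (filterᵇ-cong (λ v → cong not (burning-cong n v)) (allFin n))

  nobodyAt : ∀ {p} i → (∀ v → ¬ T (isAt (p v) i)) → placedAt p i ≡ 0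
  nobodyAt {p} i none = cong length (filter-none (T? ∘ λ v → isAt (p v) i) {xs = allFin n} (All.tabulate λ {v} _ → none v))

  Placed : Strategy n → Fin n → Set
  Placed p v = ∀ j → p v ≡ just j → ∃ λ k → j ≡ suc k × burning G r p k v ≡ false

  placed? : ∀ p v → Dec (Placed p v)
  placed? p v with p v
  ... | nothing      = yes λ _ ()
  ... | just zero    = no λ ok → case ok 0 refl of λ { (_ , () , _) }
  ... | just (suc k) with burning G r p k v Bool.≟ false
  ...   | yes ¬bk = yes λ { _ refl → k , refl , ¬bk }
  ...   | no  bk  = no λ ok → case ok (suc k) refl of λ { (_ , refl , ¬bk) → bk ¬bk }

  Bounded : Strategy n → Set
  Bounded p = ∀ v → p v ∈ options (suc n)

  valid? : ∀ {p} → Bounded p → Dec (Valid G r f p)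
  valid? {p} bounded with Finₚ.all? (placed? p) | Finₚ.all? (λ (i : Fin (suc (suc n))) → placedAt p (toℕ i) ≤? f (toℕ i))
  ... | no ¬placed | _          = no (¬placed ∘ proj₁)
  ... | yes _      | no ¬budget = no λ valid → ¬budget (proj₂ valid ∘ toℕ)
  ... | yes placed | yes budget = yes (placed , within)
    where
    within : ∀ i → placedAt p i ≤ f i
    within i with i ≤? suc n
    ... | yes i≤ = subst (λ t → placedAt p t ≤ f t) (Finₚ.toℕ-fromℕ< (s≤s i≤)) (budget (Fin.fromℕ< (s≤s i≤)))
    ... | no  i≰ = subst (_≤ f i) (sym (nobodyAt {p} i λ v at → i≰ (options-bound (bounded v) (isAt⇒≡ (p v) i at)))) z≤n

  idle-valid : Valid G r f (λ _ → nothing)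
  idle-valid = (λ _ _ ()) , λ i → subst (_≤ f i) (sym (nobodyAt {λ _ → nothing} i λ _ ())) z≤n

  optimal : ∃ λ p → Valid G r f p × ∀ q → Valid G r f q → savedCount q ≤ savedCount p
  optimal with argmax savedCount (allFunctions (options (suc n)) n) (λ p∈ → valid? (allFunctions-sound _ p∈)) idle-valid
  ... | best , valid , beats = best , valid , λ q valid-q →
    let q′ , q′∈ , q′≗ = allFunctions-complete (options (suc n)) (prune q)
                           (λ v → ∈-options (prune q v) (prune-bounded valid-q))
        prune≗q′ = λ v → sym (q′≗ v)
    in begin
      savedCount q         ≡⟨ savedCount-prune q ⟨
      savedCount (prune q) ≡⟨ savedCount-cong prune≗q′ ⟩
      savedCount q′        ≤⟨ beats q′∈ (valid-cong prune≗q′ (prune-valid valid-q)) ⟩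
      savedCount best      ∎
    where open ≤-Reasoning

lemma1 : (n : ℕ) (G : Graph n) (r : Fin n) (f : ℕ → ℕ) → Cactus G →
         Σ (Strategy n) (λ p → Optimal G r f p × ((C : Cycle G) → AtMostTwoProtected p C))
lemma1 n G r f cactus with Optimum.optimal G r f
... | p , valid , best = prune p , (prune-valid valid , optimality) , atMostTwo
  where
  open Fire G r
  open Optimum G r f using (savesAtLeast⇒≤; ≤⇒savesAtLeast)

  optimality : ∀ q → Valid G r f q → ∀ k → SavesAtLeast G r q k → SavesAtLeast G r (prune p) k
  optimality q valid-q k saves = prune-saves (≤⇒savesAtLeast (≤-trans (savesAtLeast⇒≤ saves) (best q valid-q)))

  exposed : ∀ {a} → Protected (prune p) a → Protected (prune p) a × Walks.Unblocked G (Protected (prune p)) r a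
  exposed prot = prot , prune-unblocked valid prot

  atMostTwo : (C : Cycle G) → AtMostTwoProtected (prune p) C
  atMostTwo C i j k i≢j j≢k i≢k pi pj pk =
    CactusCycle.atMostTwoExposed cactus C (Protected (prune p)) r i j k i≢j j≢k i≢k (exposed pi) (exposed pj) (exposed pk)
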